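{- Let $k\in\mathbb{Z}$, $n,j\in\mathbb{Z}^+$, and let $G=(V,E)$ be a $j$-regular simple graph. If $\gcd(j+1,n)\mid k$, then $\chi_{n,k}(G)=\chi(G)$. If $G$ is finite and $\gcd(j+1,n)\nmid k|V|$, then $\chi_{n,k}(G)$ does not exist.
   Context: Graphs may be infinite. A labeling $\ell:V\to\mathbb{Z}$ is proper if adjacent vertices get distinct labels; its order is the size of its image; $\chi(G)$ is the minimum order of a proper labeling. It is a closed coloring with remainder $k\bmod n$ if $\sum_{w\in N[v]}\ell(w)\equiv k\pmod n$ for every $v$, where $N[v]$ is the closed neighborhood of $v$. $\chi_{n,k}(G)$ exists iff a proper closed coloring with remainder $k\bmod n$ exists, and then is the minimum order of such a coloring ($\infty$ if only infinite-order ones exist). -}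

module Defs where

open import Data.Nat using (ℕ; zero; suc; _≤_)
open import Data.Fin using (Fin)
open import Data.Integer using (ℤ; +_; _+_; _-_)
open import Data.Integer.Divisibility using (_∣_)
open import Data.Product using (Σ; ∃; _×_; _,_)
open import Data.Empty using (⊥)
open import Relation.Nullary using (¬_)
open import Relation.Binary.PropositionalEquality using (_≡_)
open import Function.Definitions using (Injective)
open import Function.Bundles using (_⇔_)

-- A j-regular simple graph on an arbitrary (possibly infinite) vertex type V.
-- The neighbourhood N(v) is enumerated without repetition by nbr v : Fin j → V.
record RegularGraph (j : ℕ) : Set₁ where
  field
    V      : Set
    Adj    : V → V → Set
    sym    : ∀ {v w} → Adj v w → Adj w v
    irrefl : ∀ {v} → ¬ Adj v v
    nbr    : V → Fin j → V
    nbr-injective : ∀ v → Injective _≡_ _≡_ (nbr v)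
    nbr-complete  : ∀ v w → Adj v w ⇔ (∃ λ i → nbr v i ≡ w)

open RegularGraph public

Labeling : ∀ {j} → RegularGraph j → Set
Labeling G = V G → ℤ

Proper : ∀ {j} (G : RegularGraph j) → Labeling G → Set
Proper G ℓ = ∀ v w → Adj G v w → ¬ (ℓ v ≡ ℓ w)

sumFin : ∀ m → (Fin m → ℤ) → ℤ
sumFin zero    f = + 0
sumFin (suc m) f = f Fin.zero + sumFin m (λ i → f (Fin.suc i))

closedSum : ∀ {j} (G : RegularGraph j) → Labeling G → V G → ℤ
closedSum {j} G ℓ v = ℓ v + sumFin j (λ i → ℓ (nbr G v i))

Closed : ∀ {j} (G : RegularGraph j) → ℕ → ℤ → Labeling G → Set
Closed G n k ℓ = ∀ v → (+ n) ∣ (closedSum G ℓ v - k)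

-- the labeling ℓ has order (image size) exactly m
HasOrder : ∀ {j} (G : RegularGraph j) → Labeling G → ℕ → Set
HasOrder G ℓ m = Σ (Fin m → ℤ) λ f →
  Injective _≡_ _≡_ f × (∀ v → ∃ λ i → ℓ v ≡ f i) × (∀ i → ∃ λ v → ℓ v ≡ f i)

data ℕ∞ : Set where
  fin : ℕ → ℕ∞
  ∞   : ℕ∞

-- "the minimum order of a labeling satisfying P is c"
-- (∞ : labelings satisfying P exist, but none of finite order)
MinOrder : ∀ {j} (G : RegularGraph j) → (Labeling G → Set) → ℕ∞ → Set
MinOrder G P (fin m) =
  (∃ λ ℓ → P ℓ × HasOrder G ℓ m) × (∀ ℓ m' → P ℓ → HasOrder G ℓ m' → m ≤ m')
MinOrder G P ∞ =
  (∃ λ ℓ → P ℓ) × (∀ ℓ m' → P ℓ → ¬ HasOrder G ℓ m')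

IsChromatic : ∀ {j} → RegularGraph j → ℕ∞ → Set
IsChromatic G c = MinOrder G (Proper G) c

ChiNKExists : ∀ {j} → RegularGraph j → ℕ → ℤ → Set
ChiNKExists G n k = ∃ λ ℓ → Proper G ℓ × Closed G n k ℓ

IsChiNK : ∀ {j} → RegularGraph j → ℕ → ℤ → ℕ∞ → Set
IsChiNK G n k c = MinOrder G (λ ℓ → Proper G ℓ × Closed G n k ℓ) c

HasSize : ∀ {j} → RegularGraph j → ℕ → Set
HasSize G N = Σ (Fin N → V G) λ e →
  Injective _≡_ _≡_ e × (∀ v → ∃ λ i → e i ≡ v)

module Submission where

open import Defs
open import Data.Nat using (ℕ; suc; _≤_)
open import Data.Nat.GCD using (gcd)
open import Data.Integer using (ℤ; +_; _*_)
open import Data.Integer.Divisibility using (_∣_)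
open import Data.Product using (_×_)
open import Relation.Nullary using (¬_)
open import Function.Bundles using (_⇔_)

import Data.Nat as ℕ
import Data.Nat.GCD as ℕ
open import Data.Integer using (_+_; _-_; -_; 0ℤ; NonZero)
import Data.Integer.Properties as ℤ
import Data.Integer.Divisibility.Signed as Signed
open import Data.Integer.Tactic.RingSolver using (solve-∀)
open import Algebra.Properties.Semiring.Sum ℤ.+-*-semiring
  using (sum; sum-syntax; sum-cong-≗; ∑-distrib-+; *-distribˡ-sum; ∑-permute)
open import Algebra.Properties.AbelianGroup ℤ.+-0-abelianGroup using (∙-cancelˡ)
open import Data.Fin using (Fin; _↑ˡ_; _↑ʳ_; combine; remQuot)
open import Data.Fin.Properties using (remQuot-combine; combine-remQuot)
open import Data.Fin.Permutation using (Permutation′; permutation)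
open import Data.Product using (∃; ∃₂; _,_; proj₁; proj₂; map₂; uncurry)
open import Function.Base using (_∘_)
open import Function.Bundles using (mk⇔; Equivalence)
open import Function.Definitions using (Injective)
open import Relation.Binary.PropositionalEquality as ≡
  using (_≡_; refl; trans; cong; cong₂; subst; module ≡-Reasoning)

open ≡-Reasoning

-- A relabelling ℓ ↦ t + n ℓ is injective, so it preserves properness and order, and it
-- moves every closed-neighbourhood sum to (j + 1) t mod n; when gcd (j + 1, n) ∣ k one
-- can pick t with (j + 1) t ≡ k (mod n), so proper labelings and proper closed colorings
-- realise the same orders. Conversely, on a finite graph each vertex lies in j + 1 closed
-- neighbourhoods, so summing the N congruences gives (j + 1) Σℓ ≡ N k (mod n), whence
-- gcd (j + 1, n) ∣ k N.

sumFin≡sum : ∀ m (f : Fin m → ℤ) → sumFin m f ≡ sum f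
sumFin≡sum ℕ.zero  f = refl
sumFin≡sum (suc m) f = cong (_+_ (f Fin.zero)) (sumFin≡sum m (f ∘ Fin.suc))

sum-const : ∀ m (a : ℤ) → ∑[ i < m ] a ≡ + m * a
sum-const ℕ.zero  a = ≡.sym (ℤ.*-zeroˡ a)
sum-const (suc m) a = begin
  a + ∑[ i < m ] a ≡⟨ cong (_+_ a) (sum-const m a) ⟩
  a + + m * a      ≡⟨ distrib a (+ m) ⟩
  (+ 1 + + m) * a  ≡⟨ cong (_* a) (ℤ.pos-+ 1 m) ⟨
  + suc m * a      ∎
  where
  distrib : ∀ a m → a + m * a ≡ (+ 1 + m) * a
  distrib = solve-∀

sum-affine : ∀ m (t a : ℤ) (f : Fin m → ℤ) →
  ∑[ i < m ] (t + a * f i) ≡ + m * t + a * sum f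
sum-affine m t a f = trans (∑-distrib-+ (λ _ → t) (λ i → a * f i))
  (cong₂ _+_ (sum-const m t) (≡.sym (*-distribˡ-sum a f)))

sum-++ : ∀ m n (f : Fin (m ℕ.+ n) → ℤ) →
  sum f ≡ ∑[ i < m ] f (i ↑ˡ n) + ∑[ i < n ] f (m ↑ʳ i)
sum-++ ℕ.zero  n f = ≡.sym (ℤ.+-identityˡ (sum f))
sum-++ (suc m) n f = trans (cong (_+_ (f Fin.zero)) (sum-++ m n (f ∘ Fin.suc)))
  (≡.sym (ℤ.+-assoc (f Fin.zero) _ _))

sum-combine : ∀ m n (f : Fin (m ℕ.* n) → ℤ) →
  sum f ≡ ∑[ x < m ] ∑[ i < n ] f (combine x i)
sum-combine ℕ.zero  n f = refl
sum-combine (suc m) n f = trans (sum-++ n (m ℕ.* n) f)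
  (cong (_+_ (∑[ i < n ] f (i ↑ˡ m ℕ.* n))) (sum-combine m n (f ∘ (n ↑ʳ_))))

sum-combine-remQuot : ∀ m n (H : Fin m × Fin n → ℤ) →
  ∑[ p < m ℕ.* n ] H (remQuot {m} n p) ≡ ∑[ x < m ] ∑[ i < n ] H (x , i)
sum-combine-remQuot m n H = trans (sum-combine m n _)
  (sum-cong-≗ (λ x → sum-cong-≗ (λ i → cong H (remQuot-combine x i))))

∑∑-involution : ∀ m n (H : Fin m × Fin n → ℤ) (σ : Fin m × Fin n → Fin m × Fin n) →
  (∀ p → σ (σ p) ≡ p) →
  ∑[ x < m ] ∑[ i < n ] H (x , i) ≡ ∑[ x < m ] ∑[ i < n ] H (σ (x , i))
∑∑-involution m n H σ σ-involutive = begin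
  ∑[ x < m ] ∑[ i < n ] H (x , i)           ≡⟨ sum-combine-remQuot m n H ⟨
  ∑[ p < m ℕ.* n ] H (remQuot {m} n p)      ≡⟨ ∑-permute (H ∘ remQuot {m} n) π ⟩
  ∑[ p < m ℕ.* n ] H (remQuot {m} n (π′ p)) ≡⟨ sum-cong-≗ (λ p → cong H (remQuot-combine′ p)) ⟩
  ∑[ p < m ℕ.* n ] H (σ (remQuot {m} n p))  ≡⟨ sum-combine-remQuot m n (H ∘ σ) ⟩
  ∑[ x < m ] ∑[ i < n ] H (σ (x , i))       ∎
  where
  π′ : Fin (m ℕ.* n) → Fin (m ℕ.* n)
  π′ = uncurry combine ∘ σ ∘ remQuot {m} n
  remQuot-combine′ : ∀ p → remQuot {m} n (π′ p) ≡ σ (remQuot {m} n p)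
  remQuot-combine′ p = uncurry remQuot-combine (σ (remQuot {m} n p))
  π′-involutive : ∀ p → π′ (π′ p) ≡ p
  π′-involutive p = begin
    uncurry combine (σ (remQuot {m} n (π′ p))) ≡⟨ cong (uncurry combine ∘ σ) (remQuot-combine′ p) ⟩
    uncurry combine (σ (σ (remQuot {m} n p)))  ≡⟨ cong (uncurry combine) (σ-involutive (remQuot {m} n p)) ⟩
    uncurry combine (remQuot {m} n p)          ≡⟨ combine-remQuot {m} n p ⟩
    p                                          ∎
  π : Permutation′ (m ℕ.* n)
  π = permutation π′ π′ π′-involutive π′-involutive

∣-sum : ∀ {m} {d : ℤ} (f : Fin m → ℤ) → (∀ i → d Signed.∣ f i) → d Signed.∣ sum f
∣-sum {ℕ.zero}  f d∣f = Signed.divides 0ℤ refl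
∣-sum {suc m} f d∣f = Signed.∣m∣n⇒∣m+n (d∣f Fin.zero) (∣-sum (f ∘ Fin.suc) (d∣f ∘ Fin.suc))

pos-+-* : ∀ a b c → + (a ℕ.+ b ℕ.* c) ≡ + a + + b * + c
pos-+-* a b c = trans (ℤ.pos-+ a (b ℕ.* c)) (cong (_+_ (+ a)) (ℤ.pos-* b c))

bézout : ∀ a b → ∃₂ λ x y → x * + a + y * + b ≡ + gcd a b
bézout a b with ℕ.Bézout.identity (ℕ.gcd-GCD a b)
... | ℕ.Bézout.+- x y eq = + x , - + y , (begin
  + x * + a + - + y * + b                     ≡⟨ cong (λ z → z + - + y * + b) (ℤ.pos-* x a) ⟨
  + (x ℕ.* a) + - + y * + b                   ≡⟨ cong (λ z → + z + - + y * + b) eq ⟨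
  + (gcd a b ℕ.+ y ℕ.* b) + - + y * + b       ≡⟨ cong (λ z → z + - + y * + b) (pos-+-* (gcd a b) y b) ⟩
  + gcd a b + + y * + b + - + y * + b         ≡⟨ add-sub (+ gcd a b) (+ y) (+ b) ⟩
  + gcd a b                                   ∎)
  where
  add-sub : ∀ g y b → g + y * b + - y * b ≡ g
  add-sub = solve-∀
... | ℕ.Bézout.-+ x y eq = - + x , + y , (begin
  - + x * + a + + y * + b                     ≡⟨ cong (_+_ (- + x * + a)) (ℤ.pos-* y b) ⟨
  - + x * + a + + (y ℕ.* b)                   ≡⟨ cong (λ z → - + x * + a + + z) eq ⟨
  - + x * + a + + (gcd a b ℕ.+ x ℕ.* a)       ≡⟨ cong (_+_ (- + x * + a)) (pos-+-* (gcd a b) x a) ⟩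
  - + x * + a + (+ gcd a b + + x * + a)       ≡⟨ sub-add (+ gcd a b) (+ x) (+ a) ⟩
  + gcd a b                                   ∎)
  where
  sub-add : ∀ g x a → - x * a + (g + x * a) ≡ g
  sub-add = solve-∀

linear-congruence : ∀ a n {k} → + gcd a n Signed.∣ k → ∃₂ λ t c → + a * t - k ≡ c * + n
linear-congruence a n (Signed.divides q refl) with bézout a n
... | x , y , xa+yn≡g = q * x , - (q * y) , (begin
  + a * (q * x) - q * + gcd a n          ≡⟨ cong (λ g → + a * (q * x) - q * g) xa+yn≡g ⟨
  + a * (q * x) - q * (x * + a + y * + n) ≡⟨ cancel (+ a) (+ n) q x y ⟩
  - (q * y) * + n                        ∎)
  where
  cancel : ∀ a n q x y → a * (q * x) - q * (x * a + y * n) ≡ - (q * y) * n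
  cancel = solve-∀

affine-injective : ∀ (t a : ℤ) .{{_ : NonZero a}} → Injective _≡_ _≡_ (λ x → t + a * x)
affine-injective t a eq = ℤ.*-cancelˡ-≡ a _ _ (∙-cancelˡ t _ _ eq)

module _ {j} (G : RegularGraph j) where

  Proper-∘ : ∀ {f : ℤ → ℤ} {ℓ} → Injective _≡_ _≡_ f → Proper G ℓ → Proper G (f ∘ ℓ)
  Proper-∘ f-injective proper v w vw = proper v w vw ∘ f-injective

  HasOrder-∘ : ∀ {f : ℤ → ℤ} {ℓ m} → Injective _≡_ _≡_ f → HasOrder G ℓ m → HasOrder G (f ∘ ℓ) m
  HasOrder-∘ {f} f-injective (g , g-injective , covers , hits) =
    f ∘ g , (λ eq → g-injective (f-injective eq)) ,
    map₂ (cong f) ∘ covers , map₂ (cong f) ∘ hits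

  MinOrder-transfer : ∀ {P Q : Labeling G → Set} (T : Labeling G → Labeling G) →
    (∀ {ℓ} → P ℓ → Q ℓ) → (∀ {ℓ} → Q ℓ → P (T ℓ)) →
    (∀ {ℓ m} → HasOrder G ℓ m → HasOrder G (T ℓ) m) →
    ∀ c → MinOrder G P c ⇔ MinOrder G Q c
  MinOrder-transfer T P⇒Q Q⇒P∘T T-order (fin m) = mk⇔
    (λ ((ℓ , Pℓ , order) , minimal) → (ℓ , P⇒Q Pℓ , order) ,
      λ ℓ′ m′ Qℓ′ order′ → minimal (T ℓ′) m′ (Q⇒P∘T Qℓ′) (T-order order′))
    (λ ((ℓ , Qℓ , order) , minimal) → (T ℓ , Q⇒P∘T Qℓ , T-order order) ,
      λ ℓ′ m′ Pℓ′ order′ → minimal ℓ′ m′ (P⇒Q Pℓ′) order′)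
  MinOrder-transfer T P⇒Q Q⇒P∘T T-order ∞ = mk⇔
    (λ ((ℓ , Pℓ) , none) → (ℓ , P⇒Q Pℓ) ,
      λ ℓ′ m′ Qℓ′ → none (T ℓ′) m′ (Q⇒P∘T Qℓ′) ∘ T-order)
    (λ ((ℓ , Qℓ) , none) → (T ℓ , Q⇒P∘T Qℓ) ,
      λ ℓ′ m′ Pℓ′ → none ℓ′ m′ (P⇒Q Pℓ′))

  closedSum-sum : ∀ ℓ v → closedSum G ℓ v ≡ ℓ v + ∑[ i < j ] ℓ (nbr G v i)
  closedSum-sum ℓ v = cong (_+_ (ℓ v)) (sumFin≡sum j _)

  closedSum-affine : ∀ (t a : ℤ) ℓ v →
    closedSum G (λ w → t + a * ℓ w) v ≡ + suc j * t + a * closedSum G ℓ v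
  closedSum-affine t a ℓ v = begin
    closedSum G (λ w → t + a * ℓ w) v               ≡⟨ closedSum-sum (λ w → t + a * ℓ w) v ⟩
    t + a * ℓ v + ∑[ i < j ] (t + a * ℓ (nbr G v i)) ≡⟨ cong (_+_ (t + a * ℓ v)) (sum-affine j t a _) ⟩
    t + a * ℓ v + (+ j * t + a * S)                  ≡⟨ regroup t a (ℓ v) (+ j) S ⟩
    (+ 1 + + j) * t + a * (ℓ v + S)                  ≡⟨ cong₂ (λ s c → s * t + a * c) (ℤ.pos-+ 1 j) (closedSum-sum ℓ v) ⟨
    + suc j * t + a * closedSum G ℓ v                ∎
    where
    S : ℤ
    S = ∑[ i < j ] ℓ (nbr G v i)
    regroup : ∀ t a l j s → t + a * l + (j * t + a * s) ≡ (+ 1 + j) * t + a * (l + s)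
    regroup = solve-∀

  Closed-affine : ∀ {n k t c} → + suc j * t - k ≡ c * + n →
    ∀ ℓ → Closed G n k (λ w → t + + n * ℓ w)
  Closed-affine {n} {k} {t} {c} congruence ℓ v =
    Signed.∣⇒∣ᵤ (Signed.divides (c + closedSum G ℓ v) (begin
      closedSum G (λ w → t + + n * ℓ w) v - k ≡⟨ cong (_- k) (closedSum-affine t (+ n) ℓ v) ⟩
      + suc j * t + + n * C - k               ≡⟨ swap (+ suc j * t) (+ n * C) k ⟩
      + suc j * t - k + + n * C               ≡⟨ cong (_+ + n * C) congruence ⟩
      c * + n + + n * C                       ≡⟨ factor c (+ n) C ⟩
      (c + C) * + n                           ∎))
    where
    C : ℤ
    C = closedSum G ℓ v
    swap : ∀ s x k → s + x - k ≡ s - k + x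
    swap = solve-∀
    factor : ∀ c n x → c * n + n * x ≡ (c + x) * n
    factor = solve-∀

  chiNK⇔chi : ∀ n .{{_ : ℕ.NonZero n}} {k} → + gcd (suc j) n Signed.∣ k →
    ∀ c → IsChiNK G n k c ⇔ IsChromatic G c
  chiNK⇔chi n {k} g∣k with linear-congruence (suc j) n g∣k
  ... | t , c , congruence = MinOrder-transfer ((λ x → t + + n * x) ∘_) proj₁
    (λ {ℓ} proper → Proper-∘ (affine-injective t (+ n)) proper ,
                    Closed-affine {n} {k} {t} {c} congruence ℓ)
    (HasOrder-∘ (affine-injective t (+ n)))

module Handshake {j} (G : RegularGraph j) {N} (size : HasSize G N) where

  e : Fin N → V G
  e = proj₁ size

  e-injective : Injective _≡_ _≡_ e
  e-injective = proj₁ (proj₂ size)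

  index : V G → Fin N
  index v = proj₁ (proj₂ (proj₂ size) v)

  e-index : ∀ v → e (index v) ≡ v
  e-index v = proj₂ (proj₂ (proj₂ size) v)

  neighbour : Fin N → Fin j → Fin N
  neighbour x i = index (nbr G (e x) i)

  neighbour-adjacent : ∀ x i → Adj G (e (neighbour x i)) (e x)
  neighbour-adjacent x i = subst (λ w → Adj G w (e x)) (≡.sym (e-index _))
    (RegularGraph.sym G (Equivalence.from (nbr-complete G (e x) _) (i , refl)))

  back : ∀ x i → ∃ λ i′ → nbr G (e (neighbour x i)) i′ ≡ e x
  back x i = Equivalence.to (nbr-complete G _ (e x)) (neighbour-adjacent x i)

  -- (x , i) ↦ (y , i′) where y is the i-th neighbour of x and x is the i′-th neighbour of y
  flip : Fin N × Fin j → Fin N × Fin j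
  flip (x , i) = neighbour x i , proj₁ (back x i)

  flip-involutive : ∀ p → flip (flip p) ≡ p
  flip-involutive (x , i) =
    cong₂ _,_ y-back (nbr-injective G (e x) (trans nbr-y-back (e-index _)))
    where
    y : Fin N
    y = neighbour x i
    i′ : Fin j
    i′ = proj₁ (back x i)
    y-back : neighbour y i′ ≡ x
    y-back = e-injective (trans (e-index _) (proj₂ (back x i)))
    nbr-y-back : nbr G (e x) (proj₁ (back y i′)) ≡ e y
    nbr-y-back = subst (λ z → nbr G (e z) (proj₁ (back y i′)) ≡ e y) y-back (proj₂ (back y i′))

  sum-neighbours : ∀ ℓ → ∑[ x < N ] ∑[ i < j ] ℓ (nbr G (e x) i) ≡ + j * sum (ℓ ∘ e)
  sum-neighbours ℓ = begin
    ∑[ x < N ] ∑[ i < j ] ℓ (nbr G (e x) i)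
      ≡⟨ sum-cong-≗ (λ x → sum-cong-≗ (λ i → cong ℓ (e-index (nbr G (e x) i)))) ⟨
    ∑[ x < N ] ∑[ i < j ] ℓ (e (proj₁ (flip (x , i))))
      ≡⟨ ∑∑-involution N j (ℓ ∘ e ∘ proj₁) flip flip-involutive ⟨
    ∑[ x < N ] ∑[ i < j ] ℓ (e x)
      ≡⟨ sum-cong-≗ (λ x → sum-const j (ℓ (e x))) ⟩
    ∑[ x < N ] (+ j * ℓ (e x))
      ≡⟨ *-distribˡ-sum (+ j) (ℓ ∘ e) ⟨
    + j * sum (ℓ ∘ e) ∎

  sum-closedSum : ∀ ℓ → ∑[ x < N ] closedSum G ℓ (e x) ≡ + suc j * sum (ℓ ∘ e)
  sum-closedSum ℓ = begin
    ∑[ x < N ] closedSum G ℓ (e x)                       ≡⟨ sum-cong-≗ (closedSum-sum G ℓ ∘ e) ⟩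
    ∑[ x < N ] (ℓ (e x) + ∑[ i < j ] ℓ (nbr G (e x) i)) ≡⟨ ∑-distrib-+ (ℓ ∘ e) _ ⟩
    sum (ℓ ∘ e) + ∑[ x < N ] ∑[ i < j ] ℓ (nbr G (e x) i) ≡⟨ cong (_+_ (sum (ℓ ∘ e))) (sum-neighbours ℓ) ⟩
    sum (ℓ ∘ e) + + j * sum (ℓ ∘ e)                       ≡⟨ distrib (sum (ℓ ∘ e)) (+ j) ⟩
    (+ 1 + + j) * sum (ℓ ∘ e)                             ≡⟨ cong (_* sum (ℓ ∘ e)) (ℤ.pos-+ 1 j) ⟨
    + suc j * sum (ℓ ∘ e)                                 ∎
    where
    distrib : ∀ s j → s + j * s ≡ (+ 1 + j) * s
    distrib = solve-∀

  Closed⇒gcd∣k*N : ∀ {n k ℓ} → Closed G n k ℓ → + gcd (suc j) n Signed.∣ k * + N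
  Closed⇒gcd∣k*N {n} {k} {ℓ} closed = subst (Signed._∣_ g) (negate (+ N) k) (Signed.∣m⇒∣-m g∣Nk)
    where
    g : ℤ
    g = + gcd (suc j) n
    total : ∑[ x < N ] (closedSum G ℓ (e x) - k) ≡ + suc j * sum (ℓ ∘ e) + + N * - k
    total = trans (∑-distrib-+ (closedSum G ℓ ∘ e) (λ _ → - k))
      (cong₂ _+_ (sum-closedSum ℓ) (sum-const N (- k)))
    n∣total : + n Signed.∣ + suc j * sum (ℓ ∘ e) + + N * - k
    n∣total = subst (Signed._∣_ (+ n)) total (∣-sum _ (Signed.∣ᵤ⇒∣ ∘ closed ∘ e))
    g∣total : g Signed.∣ + suc j * sum (ℓ ∘ e) + + N * - k
    g∣total = Signed.∣-trans (Signed.∣ᵤ⇒∣ {g} {+ n} (ℕ.gcd[m,n]∣n (suc j) n)) n∣total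
    g∣Nk : g Signed.∣ + N * - k
    g∣Nk = Signed.∣m+n∣m⇒∣n g∣total
      (Signed.∣m⇒∣m*n (sum (ℓ ∘ e)) (Signed.∣ᵤ⇒∣ {g} {+ suc j} (ℕ.gcd[m,n]∣m (suc j) n)))
    negate : ∀ N k → - (N * - k) ≡ k * N
    negate = solve-∀

theorem4p4 : (k : ℤ) (n j : ℕ) → 1 ≤ n → 1 ≤ j → (G : RegularGraph j) →
    ((+ gcd (suc j) n) ∣ k → ∀ (c : ℕ∞) → IsChiNK G n k c ⇔ IsChromatic G c)
    × (∀ (N : ℕ) → HasSize G N → ¬ ((+ gcd (suc j) n) ∣ (k * + N)) → ¬ ChiNKExists G n k)
theorem4p4 k (suc n) j (ℕ.s≤s ℕ.z≤n) _ G =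
  (λ g∣k → chiNK⇔chi G (suc n) (Signed.∣ᵤ⇒∣ g∣k)) ,
  (λ N size g∤kN (ℓ , _ , closed) →
    g∤kN (Signed.∣⇒∣ᵤ (Handshake.Closed⇒gcd∣k*N G size {suc n} {k} {ℓ} closed)))
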